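{- Let $\rho=(r_1,\dots,r_n)\in\{0\}\times[0,1]\times[0,2]\times\dots\times[0,n-1]$ (i.e. $0\le r_i\le i-1$ for all $i$). Define $\alpha=(a_1,\dots,a_n)$ by $a_i=n+1-i+r_i$. Then $\alpha\in PP_n$, and for every $\rho'\in[0,n]^n$ we have $(\alpha,\rho')\in PR_n$ if and only if $r_i\le r'_i$ for all $i\in[n]$.
   Context: $[n]=\{1,\dots,n\}$, $[a,b]$ the integer interval, $PP_n=[n]^n$. For $r\ge1$, the $r$-Naples parking rule for a car with preference $a$: drive to spot $a$ and park there if free; otherwise check spots $a-1,\dots,a-r$ (only those $\ge1$) in order and park in the first free one; otherwise drive forward to the first free spot $>a$, failing if none. The $0$-Naples rule is the standard rule. Given $\alpha\in PP_n$ and $\rho\in[0,n]^n$, cars $c_1,\dots,c_n$ arrive in order at a street with spots $1,\dots,n$, car $c_i$ having preference $a_i$ and following the $r_i$-Naples rule. $PR_n$ is the set of pairs $(\alpha,\rho)$ for which all cars park. -}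

module Defs where

open import Data.Nat using (ℕ; zero; suc; _+_; _∸_; _≤_; _<ᵇ_; _≡ᵇ_)
open import Data.Bool using (Bool; true; false; not; if_then_else_)
open import Data.List using (List; []; _∷_; _++_; map; upTo)
open import Data.Bool.ListAction using (any)
open import Data.Maybe using (Maybe; just; nothing)
open import Data.Product using (_×_; ∃)
open import Data.Vec using (Vec; []; _∷_)
open import Data.Vec.Relation.Unary.All using (All)
open import Relation.Binary.PropositionalEquality using (_≡_)

-- Spots are 1..n. An occupancy state is the list of occupied spot numbers.
isFree : List ℕ → ℕ → Bool
isFree occ s = not (any (λ x → x ≡ᵇ s) occ)

firstFree : List ℕ → List ℕ → Maybe ℕ
firstFree occ []       = nothing
firstFree occ (s ∷ ss) = if isFree occ s then just s else firstFree occ ss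

bfilter : (ℕ → Bool) → List ℕ → List ℕ
bfilter p [] = []
bfilter p (x ∷ xs) = if p x then x ∷ bfilter p xs else bfilter p xs

backCands : ℕ → ℕ → List ℕ
backCands a r = map (λ i → a ∸ i) (bfilter (λ i → i <ᵇ a) (map suc (upTo r)))

fwdCands : ℕ → ℕ → List ℕ
fwdCands n a = map (λ i → a + suc i) (upTo (n ∸ a))

naplesPark : ℕ → List ℕ → ℕ → ℕ → Maybe ℕ
naplesPark n occ a r =
  if isFree occ a then just a else firstFree occ (backCands a r ++ fwdCands n a)

runCars : ∀ {k} → ℕ → List ℕ → Vec ℕ k → Vec ℕ k → Maybe (List ℕ)
runCars n occ [] [] = just occ
runCars n occ (a ∷ as) (r ∷ rs) with naplesPark n occ a r
... | nothing = nothing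
... | just s  = runCars n (s ∷ occ) as rs

InPP : (n : ℕ) → Vec ℕ n → Set
InPP n α = All (λ a → 1 ≤ a × a ≤ n) α

InRange : (n : ℕ) → Vec ℕ n → Set
InRange n ρ = All (λ r → r ≤ n) ρ

InPR : (n : ℕ) → Vec ℕ n → Vec ℕ n → Set
InPR n α ρ = InPP n α × InRange n ρ × ∃ (λ occ → runCars n [] α ρ ≡ just occ)

{-# OPTIONS --safe #-}
module Submission where

-- When the car with index i (counting from 0) arrives, spots 1 … n − i are free and all higher
-- spots are taken. If rᵢ = 0 it parks at its preference n − i. Otherwise its preference
-- n − i + rᵢ and the rᵢ − 1 spots just below it are taken, and the highest free spot n − i lies
-- exactly rᵢ steps back; so the car parks there, preserving the invariant, precisely when
-- r′ᵢ ≥ rᵢ, and otherwise every spot it may look at is taken and it fails.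

open import Defs
open import Data.Nat using (ℕ; zero; suc; _+_; _∸_; _≤_; _<_; _<ᵇ_; _≡ᵇ_; z≤n; s≤s; z<s)
open import Data.Nat.Properties
open import Data.Bool using (true; false)
open import Data.Bool.Properties using (T-≡)
open import Data.Fin using (Fin; toℕ; zero; suc)
open import Data.Fin.Properties using (toℕ≤n; toℕ<n)
open import Data.List using (List; []; _∷_; _++_; map; upTo)
open import Data.List.Properties using (map-++; ++-identityʳ; upTo-∷ʳ)
open import Data.List.Relation.Unary.All as List using ([]; _∷_)
open import Data.List.Relation.Unary.All.Properties using (++⁺; map⁺; applyUpTo⁺₁)
open import Data.Maybe using (Maybe; just; nothing)
open import Data.Product using (_×_; _,_; ∃)
open import Data.Sum using (inj₁; inj₂)
open import Data.Vec using (Vec; []; _∷_; lookup; tabulate)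
open import Data.Vec.Relation.Unary.All as Vec using ([]; _∷_)
open import Data.Vec.Relation.Unary.All.Properties using (tabulate⁺)
open import Function.Base using (_$_)
open import Function.Bundles using (_⇔_; mk⇔; Equivalence)
open import Function.Properties.Equivalence using () renaming (refl to ⇔-refl; trans to ⇔-trans)
open import Relation.Nullary using (yes; no; contradiction)
open import Relation.Binary.PropositionalEquality

Occupied : List ℕ → ℕ → Set
Occupied occ s = isFree occ s ≡ false

isFree-∷-self : ∀ occ s → Occupied (s ∷ occ) s
isFree-∷-self occ s rewrite Equivalence.to T-≡ (≡⇒≡ᵇ s s refl) = refl

isFree-∷-≢ : ∀ occ {x s} → x ≢ s → isFree (x ∷ occ) s ≡ isFree occ s
isFree-∷-≢ occ {x} {s} x≢s with x ≡ᵇ s in eq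
... | true  = contradiction (≡ᵇ⇒≡ x s (Equivalence.from T-≡ eq)) x≢s
... | false = refl

firstFree-∷-free : ∀ occ {s} xs → isFree occ s ≡ true → firstFree occ (s ∷ xs) ≡ just s
firstFree-∷-free occ xs s-free rewrite s-free = refl

firstFree-++-occupied : ∀ occ {xs} ys → List.All (Occupied occ) xs →
  firstFree occ (xs ++ ys) ≡ firstFree occ ys
firstFree-++-occupied occ ys []                 = refl
firstFree-++-occupied occ ys (occupied ∷ rest) rewrite occupied = firstFree-++-occupied occ ys rest

firstFree-occupied : ∀ occ {xs} → List.All (Occupied occ) xs → firstFree occ xs ≡ nothing
firstFree-occupied occ {xs} all-occupied =
  trans (cong (firstFree occ) (sym (++-identityʳ xs))) (firstFree-++-occupied occ [] all-occupied)

firstFree-++-just : ∀ occ xs ys {s} → firstFree occ xs ≡ just s → firstFree occ (xs ++ ys) ≡ just s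
firstFree-++-just occ (x ∷ xs) ys found with isFree occ x
... | true  = found
... | false = firstFree-++-just occ xs ys found

bfilter-++ : ∀ p xs ys → bfilter p (xs ++ ys) ≡ bfilter p xs ++ bfilter p ys
bfilter-++ p []       ys = refl
bfilter-++ p (x ∷ xs) ys with p x
... | true  = cong (x ∷_) (bfilter-++ p xs ys)
... | false = bfilter-++ p xs ys

backCands-suc : ∀ a r →
  backCands a (suc r) ≡ backCands a r ++ map (a ∸_) (bfilter (_<ᵇ a) (suc r ∷ []))
backCands-suc a r = begin
  map (a ∸_) (bfilter (_<ᵇ a) (map suc (upTo (suc r))))
    ≡⟨ cong (λ xs → map (a ∸_) (bfilter (_<ᵇ a) (map suc xs))) (sym (upTo-∷ʳ r)) ⟩
  map (a ∸_) (bfilter (_<ᵇ a) (map suc (upTo r ++ r ∷ [])))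
    ≡⟨ cong (λ xs → map (a ∸_) (bfilter (_<ᵇ a) xs)) (map-++ suc (upTo r) (r ∷ [])) ⟩
  map (a ∸_) (bfilter (_<ᵇ a) (map suc (upTo r) ++ suc r ∷ []))
    ≡⟨ cong (map (a ∸_)) (bfilter-++ (_<ᵇ a) (map suc (upTo r)) (suc r ∷ [])) ⟩
  map (a ∸_) (bfilter (_<ᵇ a) (map suc (upTo r)) ++ bfilter (_<ᵇ a) (suc r ∷ []))
    ≡⟨ map-++ (a ∸_) (bfilter (_<ᵇ a) (map suc (upTo r))) _ ⟩
  backCands a r ++ map (a ∸_) (bfilter (_<ᵇ a) (suc r ∷ [])) ∎
  where open ≡-Reasoning

All-backCands : ∀ {P : ℕ → Set} a r → (∀ i → 1 ≤ i → i ≤ r → i < a → P (a ∸ i)) →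
  List.All P (backCands a r)
All-backCands a zero    P-back = []
All-backCands {P} a (suc r) P-back rewrite backCands-suc a r =
  ++⁺ (All-backCands a r (λ i 1≤i i≤r → P-back i 1≤i (m≤n⇒m≤1+n i≤r))) last
  where
  last : List.All P (map (a ∸_) (bfilter (_<ᵇ a) (suc r ∷ [])))
  last with suc r <ᵇ a in lt
  ... | true  = P-back (suc r) (s≤s z≤n) ≤-refl (<ᵇ⇒< (suc r) a (Equivalence.from T-≡ lt)) ∷ []
  ... | false = []

firstFree-backCands-hit : ∀ occ a j r → suc j ≤ r → suc j < a → isFree occ (a ∸ suc j) ≡ true →
  (∀ i → 1 ≤ i → i ≤ j → i < a → Occupied occ (a ∸ i)) →
  firstFree occ (backCands a r) ≡ just (a ∸ suc j)
firstFree-backCands-hit occ a j (suc r) (s≤s j≤r) j<a spot-free occupied-below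
  rewrite backCands-suc a r with m≤n⇒m<n∨m≡n j≤r
... | inj₁ j<r = firstFree-++-just occ (backCands a r) _
                   (firstFree-backCands-hit occ a j r j<r j<a spot-free occupied-below)
... | inj₂ refl rewrite Equivalence.to T-≡ (<⇒<ᵇ j<a) =
  trans (firstFree-++-occupied occ (a ∸ suc j ∷ []) (All-backCands a j occupied-below))
        (firstFree-∷-free occ [] spot-free)

All-fwdCands : ∀ n a → List.All (λ s → a < s × s ≤ n) (fwdCands n a)
All-fwdCands n a = map⁺ (applyUpTo⁺₁ _ (n ∸ a) in-range)
  where
  in-range : ∀ {i} → i < n ∸ a → a < a + suc i × a + suc i ≤ n
  in-range {i} i<n∸a =
    m<m+n a z<s , subst (_≤ n) (+-comm (suc i) a) (m≤o∸n⇒m+n≤o (suc i) a≤n i<n∸a)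
    where
    a≤n : a ≤ n
    a≤n = <⇒≤ (m∸n≢0⇒n<m (λ n∸a≡0 → n≮0 (subst (i <_) n∸a≡0 i<n∸a)))

record FreeExactlyUpTo (n k : ℕ) (occ : List ℕ) : Set where
  field
    free  : ∀ s → 1 ≤ s → s ≤ k → isFree occ s ≡ true
    taken : ∀ s → k < s → s ≤ n → Occupied occ s

open FreeExactlyUpTo

FreeExactlyUpTo-[] : ∀ n → FreeExactlyUpTo n n []
FreeExactlyUpTo-[] n = record
  { free  = λ _ _ _ → refl
  ; taken = λ s n<s s≤n → contradiction s≤n (<⇒≱ n<s)
  }

FreeExactlyUpTo-park : ∀ {n k occ} → FreeExactlyUpTo n (suc k) occ → FreeExactlyUpTo n k (suc k ∷ occ)
FreeExactlyUpTo-park {n} {k} {occ} inv = record { free = free′ ; taken = taken′ }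
  where
  free′ : ∀ s → 1 ≤ s → s ≤ k → isFree (suc k ∷ occ) s ≡ true
  free′ s 1≤s s≤k = trans (isFree-∷-≢ occ (λ k+1≡s → <⇒≱ (s≤s s≤k) (≤-reflexive k+1≡s)))
                          (free inv s 1≤s (m≤n⇒m≤1+n s≤k))
  taken′ : ∀ s → k < s → s ≤ n → Occupied (suc k ∷ occ) s
  taken′ s k<s s≤n with suc k ≟ s
  ... | yes refl  = isFree-∷-self occ (suc k)
  ... | no  k+1≢s = trans (isFree-∷-≢ occ k+1≢s) (taken inv s (≤∧≢⇒< k<s k+1≢s) s≤n)

occupied-behind : ∀ {n k occ r i} → FreeExactlyUpTo n k occ → k + r ≤ n → i < r →
  Occupied occ (k + r ∸ i)
occupied-behind {n} {k} {occ} {r} {i} inv k+r≤n i<r =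
  taken inv (k + r ∸ i) k<spot (≤-trans (m∸n≤m (k + r) i) k+r≤n)
  where
  k<spot : k < k + r ∸ i
  k<spot rewrite +-∸-assoc k (<⇒≤ i<r) = m<m+n k (m<n⇒0<n∸m i<r)

naplesPark-free : ∀ n occ {a} r → isFree occ a ≡ true → naplesPark n occ a r ≡ just a
naplesPark-free n occ r a-free rewrite a-free = refl

naplesPark-taken : ∀ n occ {a} r → Occupied occ a →
  naplesPark n occ a r ≡ firstFree occ (backCands a r ++ fwdCands n a)
naplesPark-taken n occ r a-taken rewrite a-taken = refl

naplesPark-highestFree : ∀ {n m occ} r r′ → FreeExactlyUpTo n (suc m) occ →
  suc m + r ≤ n → r ≤ r′ → naplesPark n occ (suc m + r) r′ ≡ just (suc m)
naplesPark-highestFree {n} {m} {occ} zero r′ inv _ _ rewrite +-identityʳ m =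
  naplesPark-free n occ r′ (free inv (suc m) (s≤s z≤n) ≤-refl)
naplesPark-highestFree {n} {m} {occ} (suc j) r′ inv a≤n j<r′ =
  trans (naplesPark-taken n occ r′ (occupied-behind {i = 0} inv a≤n z<s)) $
  trans (firstFree-++-just occ (backCands a r′) (fwdCands n a)
          (firstFree-backCands-hit occ a j r′ j<r′ (s≤s (m≤n+m (suc j) m)) spot-free occupied-below))
        (cong just (m+n∸n≡m (suc m) (suc j)))
  where
  a : ℕ
  a = suc m + suc j
  spot-free : isFree occ (a ∸ suc j) ≡ true
  spot-free rewrite m+n∸n≡m (suc m) (suc j) = free inv (suc m) (s≤s z≤n) ≤-refl
  occupied-below : ∀ i → 1 ≤ i → i ≤ j → i < a → Occupied occ (a ∸ i)
  occupied-below i _ i≤j _ = occupied-behind inv a≤n (s≤s i≤j)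

naplesPark-fails : ∀ {n m occ} r r′ → FreeExactlyUpTo n (suc m) occ →
  suc m + r ≤ n → r′ < r → naplesPark n occ (suc m + r) r′ ≡ nothing
naplesPark-fails {n} {m} {occ} (suc j) r′ inv a≤n r′<r =
  trans (naplesPark-taken n occ r′ (occupied-behind {i = 0} inv a≤n z<s)) $
  trans (firstFree-++-occupied occ (fwdCands n a) (All-backCands a r′ occupied-back))
        (firstFree-occupied occ (List.map occupied-ahead (All-fwdCands n a)))
  where
  a : ℕ
  a = suc m + suc j
  occupied-back : ∀ i → 1 ≤ i → i ≤ r′ → i < a → Occupied occ (a ∸ i)
  occupied-back i _ i≤r′ _ = occupied-behind inv a≤n (≤-<-trans i≤r′ r′<r)
  occupied-ahead : ∀ {s} → a < s × s ≤ n → Occupied occ s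
  occupied-ahead {s} (a<s , s≤n) = taken inv s (<-trans (m<m+n (suc m) z<s) a<s) s≤n

runCars-park : ∀ {k} n occ a r {s} (as rs : Vec ℕ k) → naplesPark n occ a r ≡ just s →
  runCars n occ (a ∷ as) (r ∷ rs) ≡ runCars n (s ∷ occ) as rs
runCars-park n occ a r as rs parks with naplesPark n occ a r
runCars-park n occ a r as rs refl | just _ = refl

runCars-fail : ∀ {k} n occ a r (as rs : Vec ℕ k) → naplesPark n occ a r ≡ nothing →
  runCars n occ (a ∷ as) (r ∷ rs) ≡ nothing
runCars-fail n occ a r as rs fails with naplesPark n occ a r
runCars-fail n occ a r as rs refl | nothing = refl

isJust-cong : ∀ {A : Set} {x y : Maybe A} → x ≡ y →
  (∃ λ a → x ≡ just a) ⇔ (∃ λ a → y ≡ just a)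
isJust-cong refl = ⇔-refl

∀-lookup-∷⇔ : ∀ {A B : Set} {k} {_R_ : A → B → Set} {x y} {xs : Vec A k} {ys : Vec B k} →
  x R y → (∀ i → lookup xs i R lookup ys i) ⇔ (∀ i → lookup (x ∷ xs) i R lookup (y ∷ ys) i)
∀-lookup-∷⇔ xRy = mk⇔ (λ { tail zero → xRy ; tail (suc i) → tail i }) (λ all i → all (suc i))

prefsOf : (k : ℕ) → Vec ℕ k → Vec ℕ k
prefsOf k ρ = tabulate (λ i → k ∸ toℕ i + lookup ρ i)

runCars-prefsOf⇔ : ∀ {n k occ} (ρ ρ′ : Vec ℕ k) →
  FreeExactlyUpTo n k occ → Vec.All (_≤ n) (prefsOf k ρ) →
  (∃ λ occ′ → runCars n occ (prefsOf k ρ) ρ′ ≡ just occ′) ⇔ (∀ i → lookup ρ i ≤ lookup ρ′ i)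
runCars-prefsOf⇔ {occ = occ} [] [] _ _ = mk⇔ (λ _ ()) (λ _ → occ , refl)
runCars-prefsOf⇔ {n} {suc m} {occ} (r ∷ ρ) (r′ ∷ ρ′) inv (a≤n ∷ prefs≤n) with r ≤? r′
... | yes r≤r′ =
  ⇔-trans (isJust-cong parks) $
  ⇔-trans (runCars-prefsOf⇔ ρ ρ′ (FreeExactlyUpTo-park inv) prefs≤n) (∀-lookup-∷⇔ {_R_ = _≤_} r≤r′)
  where
  parks : runCars n occ (prefsOf (suc m) (r ∷ ρ)) (r′ ∷ ρ′) ≡ runCars n (suc m ∷ occ) (prefsOf m ρ) ρ′
  parks = runCars-park n occ (suc m + r) r′ (prefsOf m ρ) ρ′ (naplesPark-highestFree r r′ inv a≤n r≤r′)
... | no r≰r′ = mk⇔ (λ { (_ , parked) → contradiction (trans (sym fails) parked) λ () })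
                    (λ r≤ρ′ → contradiction (r≤ρ′ zero) r≰r′)
  where
  fails : runCars n occ (prefsOf (suc m) (r ∷ ρ)) (r′ ∷ ρ′) ≡ nothing
  fails = runCars-fail n occ (suc m + r) r′ (prefsOf m ρ) ρ′ (naplesPark-fails r r′ inv a≤n (≰⇒> r≰r′))

prefsOf-positive : ∀ k (ρ : Vec ℕ k) → Vec.All (1 ≤_) (prefsOf k ρ)
prefsOf-positive k ρ = tabulate⁺ λ i → ≤-trans (m<n⇒0<n∸m (toℕ<n i)) (m≤m+n (k ∸ toℕ i) (lookup ρ i))

prefsOf-≤ : ∀ n (ρ : Vec ℕ n) → (∀ i → lookup ρ i ≤ toℕ i) → Vec.All (_≤ n) (prefsOf n ρ)
prefsOf-≤ n ρ ρ≤i = tabulate⁺ λ i → begin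
  n ∸ toℕ i + lookup ρ i ≤⟨ +-monoʳ-≤ (n ∸ toℕ i) (ρ≤i i) ⟩
  n ∸ toℕ i + toℕ i      ≡⟨ m∸n+n≡m (toℕ≤n i) ⟩
  n                      ∎
  where open ≤-Reasoning

mainTheorem14 : (n : ℕ) (ρ : Vec ℕ n) →
    (∀ (i : Fin n) → lookup ρ i ≤ toℕ i) →
    InPP n (tabulate (λ i → n ∸ toℕ i + lookup ρ i))
    × ((ρ′ : Vec ℕ n) → InRange n ρ′ →
        (InPR n (tabulate (λ i → n ∸ toℕ i + lookup ρ i)) ρ′
          ⇔ (∀ (i : Fin n) → lookup ρ i ≤ lookup ρ′ i)))
mainTheorem14 n ρ ρ≤i = prefs-inPP , λ ρ′ ρ′≤n →
  mk⇔ (λ { (_ , _ , parked) → Equivalence.to (parks⇔ ρ′) parked })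
      (λ ρ≤ρ′ → prefs-inPP , ρ′≤n , Equivalence.from (parks⇔ ρ′) ρ≤ρ′)
  where
  prefs≤n : Vec.All (_≤ n) (prefsOf n ρ)
  prefs≤n = prefsOf-≤ n ρ ρ≤i
  prefs-inPP : InPP n (prefsOf n ρ)
  prefs-inPP = Vec.zip (prefsOf-positive n ρ , prefs≤n)
  parks⇔ : ∀ ρ′ → (∃ λ occ → runCars n [] (prefsOf n ρ) ρ′ ≡ just occ) ⇔ (∀ i → lookup ρ i ≤ lookup ρ′ i)
  parks⇔ ρ′ = runCars-prefsOf⇔ ρ ρ′ (FreeExactlyUpTo-[] n) prefs≤n
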